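{- If $n$ is a non-negative integer, then \[ \sum_{k = 1}^n \sum_{j = 0}^{k - 1} (-1)^{k-j+1} F_{n-j} = F_{2(\lfloor (n-1)/2 \rfloor + 1)} \quad\text{and}\quad \sum_{k = 1}^n \sum_{j = 0}^{k - 1} (-1)^{k-j+1} L_{n-j} = L_{2(\lfloor (n-1)/2 \rfloor + 1)} - 2. \]
   Context: $F_n$ are the Fibonacci numbers ($F_0=0$, $F_1=1$, $F_{n}=F_{n-1}+F_{n-2}$) and $L_n$ the Lucas numbers ($L_0=2$, $L_1=1$, $L_n=L_{n-1}+L_{n-2}$). Empty sums are $0$. -}

module Defs where

open import Data.Nat as ℕ using (ℕ; zero; suc)
open import Data.Integer as ℤ using (ℤ; +_; ∣_∣)
open import Data.Integer.DivMod using (_/_)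

F : ℕ → ℤ
F zero = + 0
F (suc zero) = + 1
F (suc (suc n)) = F (suc n) ℤ.+ F n

L : ℕ → ℤ
L zero = + 2
L (suc zero) = + 1
L (suc (suc n)) = L (suc n) ℤ.+ L n

-- Σ[ i = a .. b ] f i  (inclusive; empty, i.e. 0, when b < a)
-- sumFrom a m f = f a + f (a+1) + ... + f (a+m-1)
sumFrom : ℕ → ℕ → (ℕ → ℤ) → ℤ
sumFrom a zero f = + 0
sumFrom a (suc m) f = f a ℤ.+ sumFrom (suc a) m f

sumRange : ℕ → ℕ → (ℕ → ℤ) → ℤ
sumRange a b f = sumFrom a (suc b ℕ.∸ a) f

sgn : ℕ → ℤ
sgn m = ℤ.-1ℤ ℤ.^ m

-- floor((n-1)/2), computed in ℤ with floor (Euclidean, positive divisor) division;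
-- for n = 0 this is floor(-1/2) = -1.
halfIdx : ℕ → ℤ
halfIdx n = (+ n ℤ.- + 1) / (+ 2)

-- the index 2 (floor((n-1)/2) + 1), which is a non-negative integer
idx : ℕ → ℕ
idx n = ∣ + 2 ℤ.* (halfIdx n ℤ.+ + 1) ∣

-- inner term (-1)^(k-j+1) G_{n-j}, for 0 ≤ j ≤ k-1 (so k - j + 1 ≥ 2 is a genuine natural)
term : (ℕ → ℤ) → ℕ → ℕ → ℕ → ℤ
term G n k j = sgn (k ℕ.∸ j ℕ.+ 1) ℤ.* G (n ℕ.∸ j)

doubleSum : (ℕ → ℤ) → ℕ → ℤ
doubleSum G n = sumRange 1 n (λ k → sumRange 0 (k ℕ.∸ 1) (λ j → term G n k j))

{-# OPTIONS --safe #-}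
-- Write r k = Σ_{j<k} (-1)^(k-j+1) G_{n-j} for the k-th inner sum. Splitting off its last term
-- gives r (k+1) = G_{n-k} - r k, so the last two inner sums (k = n-1, n) add up to G_1, and the
-- remaining ones are exactly the inner sums for n-2 with G shifted by two. Hence the double sum
-- is G_1 + G_3 + ... + G_{idx n - 1}, which telescopes to G_{idx n} - G_0 for every sequence
-- satisfying the Fibonacci recurrence.
module Submission where

open import Defs
open import Data.Nat using (ℕ)
open import Data.Integer using (ℤ; +_; _-_)
open import Data.Product using (_×_)
open import Relation.Binary.PropositionalEquality using (_≡_)

open import Data.Nat as ℕ using (zero; suc; _∸_; _≤_; _<_; z≤n; s≤s)
import Data.Nat.Properties as ℕ
open import Data.Nat.DivMod using (m/n≡1+[m∸n]/n)
open import Data.Integer using (_+_; _*_; -_; 1ℤ; ∣_∣)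
open import Data.Integer.Properties
  using (+-assoc; +-comm; +-identityʳ; +-inverseʳ; *-identityˡ; -1*i≡-i; neg-distrib-+; neg-distribˡ-*; pos-*)
open import Data.Integer.Tactic.RingSolver using (solve-∀)
open import Data.Product using (_,_)
open import Function using (_∘_)
open import Relation.Binary.PropositionalEquality using (refl; sym; trans; cong; cong₂; module ≡-Reasoning)
open ≡-Reasoning

sumFrom-shift : ∀ a m (f : ℕ → ℤ) → sumFrom (suc a) m f ≡ sumFrom a m (f ∘ suc)
sumFrom-shift a zero    f = refl
sumFrom-shift a (suc m) f = cong (λ s → f (suc a) + s) (sumFrom-shift (suc a) m f)

sumFrom-cong : ∀ m {f g : ℕ → ℤ} → (∀ i → i < m → f i ≡ g i) → sumFrom 0 m f ≡ sumFrom 0 m g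
sumFrom-cong zero    f≗g = refl
sumFrom-cong (suc m) {f} {g} f≗g = cong₂ _+_ (f≗g 0 (s≤s z≤n)) (begin
  sumFrom 1 m f         ≡⟨ sumFrom-shift 0 m f ⟩
  sumFrom 0 m (f ∘ suc) ≡⟨ sumFrom-cong m (λ i i<m → f≗g (suc i) (s≤s i<m)) ⟩
  sumFrom 0 m (g ∘ suc) ≡⟨ sumFrom-shift 0 m g ⟨
  sumFrom 1 m g         ∎)

sumFrom-snoc : ∀ a m (f : ℕ → ℤ) → sumFrom a (suc m) f ≡ sumFrom a m f + f (a ℕ.+ m)
sumFrom-snoc a zero    f = trans (+-comm (f a) (+ 0)) (cong (λ i → + 0 + f i) (sym (ℕ.+-identityʳ a)))
sumFrom-snoc a (suc m) f = begin
  f a + sumFrom (suc a) (suc m) f               ≡⟨ cong (λ s → f a + s) (sumFrom-snoc (suc a) m f) ⟩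
  f a + (sumFrom (suc a) m f + f (suc a ℕ.+ m)) ≡⟨ +-assoc (f a) _ _ ⟨
  sumFrom a (suc m) f + f (suc a ℕ.+ m)         ≡⟨ cong (λ i → sumFrom a (suc m) f + f i) (ℕ.+-suc a m) ⟨
  sumFrom a (suc m) f + f (a ℕ.+ suc m)         ∎

sumFrom-neg : ∀ a m (f : ℕ → ℤ) → sumFrom a m (-_ ∘ f) ≡ - sumFrom a m f
sumFrom-neg a zero    f = refl
sumFrom-neg a (suc m) f =
  trans (cong (λ s → - f a + s) (sumFrom-neg (suc a) m f)) (sym (neg-distrib-+ (f a) _))

sgn-suc : ∀ m → sgn (suc m) ≡ - sgn m
sgn-suc m = -1*i≡-i (sgn m)

innerSum : (ℕ → ℤ) → ℕ → ℕ → ℤ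
innerSum G n k = sumFrom 0 k (term G n k)

doubleSum≡sum-innerSum : ∀ G n → doubleSum G n ≡ sumFrom 0 n (innerSum G n ∘ suc)
doubleSum≡sum-innerSum G n = sumFrom-shift 0 n _

innerSum-suc : ∀ G n k → innerSum G n (suc k) ≡ G (n ∸ k) - innerSum G n k
innerSum-suc G n k = begin
  innerSum G n (suc k)
    ≡⟨ sumFrom-snoc 0 k (term G n (suc k)) ⟩
  sumFrom 0 k (term G n (suc k)) + term G n (suc k) k
    ≡⟨ cong₂ _+_ (trans (sumFrom-cong k term-suc) (sumFrom-neg 0 k _)) last-term ⟩
  - innerSum G n k + G (n ∸ k)
    ≡⟨ +-comm (- innerSum G n k) _ ⟩
  G (n ∸ k) - innerSum G n k ∎
  where
  term-suc : ∀ j → j < k → term G n (suc k) j ≡ - term G n k j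
  term-suc j j<k = begin
    sgn (suc k ∸ j ℕ.+ 1) * G (n ∸ j)   ≡⟨ cong (λ e → sgn (e ℕ.+ 1) * G (n ∸ j)) (ℕ.+-∸-assoc 1 (ℕ.<⇒≤ j<k)) ⟩
    sgn (suc (k ∸ j ℕ.+ 1)) * G (n ∸ j) ≡⟨ cong (_* G (n ∸ j)) (sgn-suc (k ∸ j ℕ.+ 1)) ⟩
    - sgn (k ∸ j ℕ.+ 1) * G (n ∸ j)     ≡⟨ neg-distribˡ-* (sgn (k ∸ j ℕ.+ 1)) (G (n ∸ j)) ⟨
    - term G n k j                      ∎
  last-term : term G n (suc k) k ≡ G (n ∸ k)
  last-term = trans (cong (λ e → sgn (e ℕ.+ 1) * G (n ∸ k)) (ℕ.m+n∸n≡m 1 k)) (*-identityˡ _)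

innerSum-consecutive : ∀ G n k → innerSum G n (suc k) + innerSum G n (suc (suc k)) ≡ G (n ∸ suc k)
innerSum-consecutive G n k = begin
  r + innerSum G n (suc (suc k)) ≡⟨ cong (λ s → r + s) (innerSum-suc G n (suc k)) ⟩
  r + (G (n ∸ suc k) - r)        ≡⟨ x+[y-x]≡y r (G (n ∸ suc k)) ⟩
  G (n ∸ suc k)                  ∎
  where
  r = innerSum G n (suc k)
  x+[y-x]≡y : ∀ x y → x + (y - x) ≡ y
  x+[y-x]≡y = solve-∀

innerSum-shift : ∀ G n k → k ≤ n → innerSum G (suc (suc n)) k ≡ innerSum (G ∘ suc ∘ suc) n k
innerSum-shift G n k k≤n = sumFrom-cong k (λ j j<k →
  cong (λ i → sgn (k ∸ j ℕ.+ 1) * G i) (ℕ.+-∸-assoc 2 (ℕ.≤-trans (ℕ.<⇒≤ j<k) k≤n)))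

doubleSum-suc-suc : ∀ G n → doubleSum G (suc (suc n)) ≡ doubleSum (G ∘ suc ∘ suc) n + G 1
doubleSum-suc-suc G n = begin
  doubleSum G (suc (suc n))
    ≡⟨ doubleSum≡sum-innerSum G (suc (suc n)) ⟩
  sumFrom 0 (suc (suc n)) r
    ≡⟨ sumFrom-snoc 0 (suc n) r ⟩
  sumFrom 0 (suc n) r + r (suc n)
    ≡⟨ cong (_+ r (suc n)) (sumFrom-snoc 0 n r) ⟩
  sumFrom 0 n r + r n + r (suc n)
    ≡⟨ +-assoc (sumFrom 0 n r) (r n) (r (suc n)) ⟩
  sumFrom 0 n r + (r n + r (suc n))
    ≡⟨ cong₂ _+_ (sumFrom-cong n (λ k k<n → innerSum-shift G n (suc k) k<n))
                 (innerSum-consecutive G (suc (suc n)) n) ⟩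
  sumFrom 0 n (innerSum (G ∘ suc ∘ suc) n ∘ suc) + G (suc n ∸ n)
    ≡⟨ cong₂ _+_ (sym (doubleSum≡sum-innerSum (G ∘ suc ∘ suc) n)) (cong G (ℕ.m+n∸n≡m 1 n)) ⟩
  doubleSum (G ∘ suc ∘ suc) n + G 1 ∎
  where
  r = innerSum G (suc (suc n)) ∘ suc

doubleSum-1 : ∀ G → doubleSum G 1 ≡ G 1
doubleSum-1 G = trans (+-identityʳ _) (trans (+-identityʳ _) (*-identityˡ (G 1)))

idx-suc : ∀ k → idx (suc k) ≡ 2 ℕ.+ 2 ℕ.* (k ℕ./ 2)
idx-suc k = begin
  -- the floor division (+ k) / (+ 2) unfolds to 1ℤ * + (k / 2)
  ∣ + 2 * (1ℤ * + q + + 1) ∣ ≡⟨ cong (λ i → ∣ + 2 * (i + + 1) ∣) (*-identityˡ (+ q)) ⟩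
  ∣ + 2 * + (q ℕ.+ 1) ∣      ≡⟨ cong ∣_∣ (pos-* 2 (q ℕ.+ 1)) ⟨
  2 ℕ.* (q ℕ.+ 1)            ≡⟨ cong (2 ℕ.*_) (ℕ.+-comm q 1) ⟩
  2 ℕ.* suc q                ≡⟨ ℕ.*-suc 2 q ⟩
  2 ℕ.+ 2 ℕ.* q              ∎
  where
  q = k ℕ./ 2

idx-suc-suc : ∀ n → idx (suc (suc n)) ≡ suc (suc (idx n))
idx-suc-suc zero    = refl
idx-suc-suc (suc k) = begin
  idx (suc (suc (suc k)))             ≡⟨ idx-suc (suc (suc k)) ⟩
  2 ℕ.+ 2 ℕ.* (suc (suc k) ℕ./ 2)     ≡⟨ cong (λ q → 2 ℕ.+ 2 ℕ.* q) (m/n≡1+[m∸n]/n {suc (suc k)} {2} (s≤s (s≤s z≤n))) ⟩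
  2 ℕ.+ 2 ℕ.* suc (k ℕ./ 2)           ≡⟨ cong (2 ℕ.+_) (ℕ.*-suc 2 (k ℕ./ 2)) ⟩
  2 ℕ.+ (2 ℕ.+ 2 ℕ.* (k ℕ./ 2))       ≡⟨ cong (2 ℕ.+_) (idx-suc k) ⟨
  2 ℕ.+ idx (suc k)                   ∎

FibonacciLike : (ℕ → ℤ) → Set
FibonacciLike G = ∀ m → G (suc (suc m)) ≡ G (suc m) + G m

doubleSum-fibonacciLike : ∀ G → FibonacciLike G → ∀ n → doubleSum G n ≡ G (idx n) - G 0
doubleSum-fibonacciLike G fib zero          = sym (+-inverseʳ (G 0))
doubleSum-fibonacciLike G fib (suc zero)    = begin
  doubleSum G 1         ≡⟨ doubleSum-1 G ⟩
  G 1                   ≡⟨ x≡x+y-y (G 1) (G 0) ⟩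
  G 1 + G 0 - G 0       ≡⟨ cong (_- G 0) (fib 0) ⟨
  G 2 - G 0             ∎
  where
  x≡x+y-y : ∀ x y → x ≡ x + y - y
  x≡x+y-y = solve-∀
doubleSum-fibonacciLike G fib (suc (suc n)) = begin
  doubleSum G (suc (suc n))
    ≡⟨ doubleSum-suc-suc G n ⟩
  doubleSum (G ∘ suc ∘ suc) n + G 1
    ≡⟨ cong (_+ G 1) (doubleSum-fibonacciLike (G ∘ suc ∘ suc) (fib ∘ suc ∘ suc) n) ⟩
  G (suc (suc (idx n))) - G 2 + G 1
    ≡⟨ cong (λ g₂ → G (suc (suc (idx n))) - g₂ + G 1) (fib 0) ⟩
  G (suc (suc (idx n))) - (G 1 + G 0) + G 1
    ≡⟨ x-[y+z]+y≡x-z (G (suc (suc (idx n)))) (G 1) (G 0) ⟩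
  G (suc (suc (idx n))) - G 0
    ≡⟨ cong (λ i → G i - G 0) (idx-suc-suc n) ⟨
  G (idx (suc (suc n))) - G 0 ∎
  where
  x-[y+z]+y≡x-z : ∀ x y z → x - (y + z) + y ≡ x - z
  x-[y+z]+y≡x-z = solve-∀

proposition4 : (n : ℕ) →
    (doubleSum F n ≡ F (idx n)) × (doubleSum L n ≡ L (idx n) - + 2)
proposition4 n =
  trans (doubleSum-fibonacciLike F (λ _ → refl) n) (+-identityʳ (F (idx n))) ,
  doubleSum-fibonacciLike L (λ _ → refl) n
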